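{- Let $(M,\gamma,k,r)$ be a YES-instance of FDMC. Then there is a fair $m\times n$ matrix $M^*$ that differs from $M$ in at most $k$ entries and has at most $r$ distinct rows, such that for every cluster $S=\{s_1,\dots,s_{|S|}\}$ of $M^*$ and every column $j\in[n]$, the value $M^*[s_1,j]$ is a winner of the majority vote over the multiset $\{M[s_i,j]: i\in[|S|]\}$, i.e., a value occurring most frequently in that multiset (ties broken arbitrarily).
   Context: An instance of \textsc{Fair Discrete Means Cluster Editing} (FDMC) consists of an $m\times n$ matrix $M$ (over some finite domain), a vector $\gamma\in[c]^m$ (the color of row $i$ is $\gamma[i]$), and positive integers $k$ and $r$. A cluster of a matrix is a maximal set of pairwise identical rows (identified with the set of their row indices). For a color $i\in[c]$ let $|\gamma|_i$ be the number of entries of $\gamma$ equal to $i$. A matrix $M'$ with $m$ rows is fair (w.r.t. $\gamma$) if every cluster $S$ of $M'$ contains exactly $\frac{|\gamma|_i}{m}|S|$ rows of color $i$, for every $i\in[c]$. The instance is a YES-instance if there exists a fair $m\times n$ matrix $M'$ that differs from $M$ in at most $k$ entries and has at most $r$ distinct rows. -}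

module Defs where

open import Data.Nat using (ℕ; zero; suc; _+_; _*_; _≤_)
open import Data.Fin using (Fin; zero; suc)
open import Data.Product using (Σ; _×_)
open import Relation.Nullary using (Dec; yes; no; ¬_; ¬?; _×-dec_)
import Data.Fin
open import Relation.Unary using (Pred; Decidable)
open import Relation.Binary.PropositionalEquality using (_≡_)
open import Relation.Binary.Definitions using (DecidableEquality)
open import Level using (0ℓ)

count : ∀ {n} {P : Pred (Fin n) 0ℓ} → Decidable P → ℕ
count {zero} P? = 0
count {suc n} P? with P? zero
... | yes _ = suc (count (λ i → P? (suc i)))
... | no  _ = count (λ i → P? (suc i))

Matrix : Set → ℕ → ℕ → Set
Matrix A m n = Fin m → Fin n → A

sumFin : ∀ {n} → (Fin n → ℕ) → ℕ
sumFin {zero} f = 0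
sumFin {suc n} f = f zero + sumFin (λ i → f (suc i))

module _ {A : Set} (_≟_ : DecidableEquality A) where

  SameRow : ∀ {m n} → Matrix A m n → Fin m → Fin m → Set
  SameRow M i i' = ∀ j → M i j ≡ M i' j

  sameRow? : ∀ {m n} (M : Matrix A m n) (i i' : Fin m) → Dec (SameRow M i i')
  sameRow? {n = zero} M i i' = yes (λ ())
  sameRow? {n = suc n} M i i' with M i zero ≟ M i' zero
                                 | sameRow? {n = n} (λ a j → M a (suc j)) i i'
  ... | yes p | yes q = yes λ { zero → p ; (suc j) → q j }
  ... | no ¬p | _     = no λ h → ¬p (h zero)
  ... | yes _ | no ¬q = no λ h → ¬q (λ j → h (suc j))

  dist : ∀ {m n} → Matrix A m n → Matrix A m n → ℕ
  dist M M' = sumFin (λ i → count (λ j → ¬? (M i j ≟ M' i j)))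

  -- the cluster of M' containing row s is { i | SameRow M' i s }.
  -- Fairness: every cluster S contains exactly (|γ|_col / m)·|S| rows of
  -- colour col, written without division as  m · |S ∩ col| = |γ|_col · |S|.
  Fair : ∀ {m n c} → Matrix A m n → (Fin m → Fin c) → Set
  Fair {m} {n} {c} M' γ =
    ∀ (s : Fin m) (col : Fin c) →
      m * count (λ i → sameRow? M' i s ×-dec (γ i Data.Fin.≟ col))
        ≡ count (λ i → γ i Data.Fin.≟ col) * count (λ i → sameRow? M' i s)

  AtMostDistinctRows : ∀ {m n} → Matrix A m n → ℕ → Set
  AtMostDistinctRows {m} {n} M' r =
    Σ (Fin r → Fin n → A) λ R → ∀ (i : Fin m) → Σ (Fin r) λ t → ∀ j → M' i j ≡ R t j

  Solution : ∀ {m n c} → Matrix A m n → (Fin m → Fin c) → ℕ → ℕ → Matrix A m n → Set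
  Solution M γ k r M' = Fair M' γ × dist M M' ≤ k × AtMostDistinctRows M' r

  YesInstance : ∀ {m n c} → Matrix A m n → (Fin m → Fin c) → ℕ → ℕ → Set
  YesInstance M γ k r = Σ _ λ M' → Solution M γ k r M'

  MajorityConsistent : ∀ {m n} → Matrix A m n → Matrix A m n → Set
  MajorityConsistent {m} {n} M M* =
    ∀ (s : Fin m) (j : Fin n) (v : A) →
      count (λ i → sameRow? M* i s ×-dec (M i j ≟ v))
        ≤ count (λ i → sameRow? M* i s ×-dec (M i j ≟ M* s j))

-- A solution of minimum distance is already majority-consistent. Indeed, if in
-- some cluster C of a solution and some column j the common value w is beaten
-- by a value v (more rows of C carry v than w in column j of M), then writing v
-- into column j of every row of C lowers the distance to M by
-- #{i ∈ C | M[i,j] = v} - #{i ∈ C | M[i,j] = w} > 0. The rows stay identical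
-- within C, so C is at worst merged with one other cluster; the union of two
-- disjoint fair clusters is fair, and the number of distinct rows cannot grow.
-- As the distance strictly decreases, repeating this step terminates.
module Submission where

open import Data.Bool using (if_then_else_)
open import Data.Empty using (⊥-elim)
open import Data.Fin using (Fin; zero; suc)
import Data.Fin as Fin
open import Data.Fin.Properties using (any?; all?; suc-injective)
open import Data.Nat using (ℕ; zero; suc; _+_; _*_; _≤_; _<_; _<?_; z≤n)
open import Data.Nat.Induction using (<-wellFounded)
open import Data.Nat.Properties
  using ( +-assoc; +-suc; *-zeroʳ; *-distribˡ-+; ≤-trans; <⇒≤; ≮⇒≥; +-cancelʳ-<; +-monoʳ-<
        ; +-commutativeSemigroup)
open import Algebra.Properties.CommutativeSemigroup +-commutativeSemigroup
  using (interchange; xy∙z≈xz∙y)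
open import Data.Product using (Σ; ∃; _×_; _,_; proj₁; proj₂; map₁)
open import Data.Sum using (_⊎_; inj₁; inj₂; map₂)
open import Data.Vec.Functional using (updateAt)
open import Data.Vec.Functional.Properties using (updateAt-updates; updateAt-minimal)
open import Function using (_∘_; const; _on_)
open import Induction.WellFounded using (Acc; acc)
open import Level using (0ℓ)
import Relation.Binary.Construct.On as On
open import Relation.Binary.Definitions using (DecidableEquality)
open import Relation.Binary.PropositionalEquality
open import Relation.Nullary using (Dec; yes; no; ¬_; ¬?; _×-dec_; does)
open import Relation.Unary using (Pred; Decidable; _≐_; _∪_; _∩_; _⊥_; Empty; Satisfiable)
open import Relation.Unary.Properties using (_∪?_; _∩?_)

open import Defs

𝟙 : ∀ {p} {P : Set p} → Dec P → ℕ
𝟙 P? = if does P? then 1 else 0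

𝟙-¬?+𝟙 : ∀ {p} {P : Set p} (P? : Dec P) → 𝟙 (¬? P?) + 𝟙 P? ≡ 1
𝟙-¬?+𝟙 (yes _) = refl
𝟙-¬?+𝟙 (no _)  = refl

sumFin-cong : ∀ {n} {f g : Fin n → ℕ} → (∀ i → f i ≡ g i) → sumFin f ≡ sumFin g
sumFin-cong {zero}  _ = refl
sumFin-cong {suc n} f≗g = cong₂ _+_ (f≗g zero) (sumFin-cong (f≗g ∘ suc))

sumFin-+ : ∀ {n} (f g : Fin n → ℕ) → sumFin (λ i → f i + g i) ≡ sumFin f + sumFin g
sumFin-+ {zero}  f g = refl
sumFin-+ {suc n} f g =
  trans (cong (f zero + g zero +_) (sumFin-+ (f ∘ suc) (g ∘ suc)))
        (interchange (f zero) (g zero) _ _)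

sumFin-+-cong : ∀ {n} {f g a b : Fin n → ℕ} → (∀ i → f i + a i ≡ g i + b i) →
                sumFin f + sumFin a ≡ sumFin g + sumFin b
sumFin-+-cong {f = f} {g} {a} {b} eq =
  trans (sym (sumFin-+ f a)) (trans (sumFin-cong eq) (sumFin-+ g b))

sumFin-+-agreeExcept : ∀ {n} {f g : Fin n → ℕ} (j₀ : Fin n) {a b : ℕ} →
                       (∀ j → j ≢ j₀ → f j ≡ g j) → f j₀ + a ≡ g j₀ + b →
                       sumFin f + a ≡ sumFin g + b
sumFin-+-agreeExcept {f = f} {g} zero {a} {b} agree eq = begin
  f zero + sumFin (f ∘ suc) + a  ≡⟨ xy∙z≈xz∙y (f zero) _ a ⟩
  f zero + a + sumFin (f ∘ suc)  ≡⟨ cong₂ _+_ eq (sumFin-cong λ j → agree (suc j) λ ()) ⟩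
  g zero + b + sumFin (g ∘ suc)  ≡⟨ xy∙z≈xz∙y (g zero) b _ ⟩
  g zero + sumFin (g ∘ suc) + b  ∎
  where open ≡-Reasoning
sumFin-+-agreeExcept {f = f} {g} (suc j₀) {a} {b} agree eq = begin
  f zero + sumFin (f ∘ suc) + a    ≡⟨ +-assoc (f zero) _ a ⟩
  f zero + (sumFin (f ∘ suc) + a)  ≡⟨ cong₂ _+_ (agree zero λ ()) (sumFin-+-agreeExcept j₀ agree′ eq) ⟩
  g zero + (sumFin (g ∘ suc) + b)  ≡⟨ +-assoc (g zero) _ b ⟨
  g zero + sumFin (g ∘ suc) + b    ∎
  where
  open ≡-Reasoning
  agree′ : ∀ j → j ≢ j₀ → f (suc j) ≡ g (suc j)
  agree′ j j≢j₀ = agree (suc j) (j≢j₀ ∘ suc-injective)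

count≡sumFin-𝟙 : ∀ {n} {P : Pred (Fin n) 0ℓ} (P? : Decidable P) → count P? ≡ sumFin (𝟙 ∘ P?)
count≡sumFin-𝟙 {zero}  _ = refl
count≡sumFin-𝟙 {suc n} P? with P? zero
... | yes _ = cong suc (count≡sumFin-𝟙 (P? ∘ suc))
... | no  _ = count≡sumFin-𝟙 (P? ∘ suc)

count-cong : ∀ {n} {P Q : Pred (Fin n) 0ℓ} (P? : Decidable P) (Q? : Decidable Q) →
             P ≐ Q → count P? ≡ count Q?
count-cong {zero}  _ _ _ = refl
count-cong {suc n} P? Q? (P⊆Q , Q⊆P) with P? zero | Q? zero
... | yes _ | yes _ = cong suc (count-cong (P? ∘ suc) (Q? ∘ suc) (P⊆Q , Q⊆P))
... | no  _ | no  _ = count-cong (P? ∘ suc) (Q? ∘ suc) (P⊆Q , Q⊆P)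
... | yes p | no ¬q = ⊥-elim (¬q (P⊆Q p))
... | no ¬p | yes q = ⊥-elim (¬p (Q⊆P q))

count-empty : ∀ {n} {P : Pred (Fin n) 0ℓ} (P? : Decidable P) → Empty P → count P? ≡ 0
count-empty {zero}  _ _ = refl
count-empty {suc n} P? empty with P? zero
... | yes p = ⊥-elim (empty zero p)
... | no  _ = count-empty (P? ∘ suc) (empty ∘ suc)

count-∪ : ∀ {n} {P Q : Pred (Fin n) 0ℓ} (P? : Decidable P) (Q? : Decidable Q) →
          P ⊥ Q → count (P? ∪? Q?) ≡ count P? + count Q?
count-∪ {zero}  _ _ _ = refl
count-∪ {suc n} P? Q? P⊥Q with P? zero | Q? zero
... | yes p | yes q = ⊥-elim (P⊥Q (p , q))
... | yes _ | no  _ = cong suc (count-∪ (P? ∘ suc) (Q? ∘ suc) P⊥Q)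
... | no  _ | yes _ = trans (cong suc (count-∪ (P? ∘ suc) (Q? ∘ suc) P⊥Q)) (sym (+-suc _ _))
... | no  _ | no  _ = count-∪ (P? ∘ suc) (Q? ∘ suc) P⊥Q

0<count⇒Satisfiable : ∀ {n} {P : Pred (Fin n) 0ℓ} (P? : Decidable P) → 0 < count P? → Satisfiable P
0<count⇒Satisfiable {suc n} P? 0<count with P? zero
... | yes p = zero , p
... | no  _ with 0<count⇒Satisfiable (P? ∘ suc) 0<count
...   | i , p = suc i , p

-- Stated so that Fair M γ unfolds to ∀ s → Balanced γ (cluster? M s).
Balanced : ∀ {m c} → (Fin m → Fin c) → {P : Pred (Fin m) 0ℓ} → Decidable P → Set
Balanced {m} γ P? =
  ∀ col → m * count (P? ∩? λ i → γ i Fin.≟ col) ≡ count (λ i → γ i Fin.≟ col) * count P?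

module _ {m c : ℕ} {γ : Fin m → Fin c} where

  Colour : Fin c → Pred (Fin m) 0ℓ
  Colour col i = γ i ≡ col

  colour? : (col : Fin c) → Decidable (Colour col)
  colour? col i = γ i Fin.≟ col

  Balanced-cong : {P Q : Pred (Fin m) 0ℓ} (P? : Decidable P) (Q? : Decidable Q) →
                  P ≐ Q → Balanced γ P? → Balanced γ Q?
  Balanced-cong P? Q? P≐Q@(P⊆Q , Q⊆P) balanced col = begin
    m * count (Q? ∩? colour? col)
      ≡⟨ cong (m *_) (count-cong (Q? ∩? colour? col) (P? ∩? colour? col) (map₁ Q⊆P , map₁ P⊆Q)) ⟩
    m * count (P? ∩? colour? col)
      ≡⟨ balanced col ⟩
    count (colour? col) * count P?
      ≡⟨ cong (count (colour? col) *_) (count-cong P? Q? P≐Q) ⟩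
    count (colour? col) * count Q?
      ∎
    where open ≡-Reasoning

  Balanced-empty : {P : Pred (Fin m) 0ℓ} (P? : Decidable P) → Empty P → Balanced γ P?
  Balanced-empty P? empty col = begin
    m * count (P? ∩? colour? col)
      ≡⟨ cong (m *_) (count-empty (P? ∩? colour? col) (λ i → empty i ∘ proj₁)) ⟩
    m * 0
      ≡⟨ *-zeroʳ m ⟩
    0
      ≡⟨ *-zeroʳ (count (colour? col)) ⟨
    count (colour? col) * 0
      ≡⟨ cong (count (colour? col) *_) (count-empty P? empty) ⟨
    count (colour? col) * count P?
      ∎
    where open ≡-Reasoning

  Balanced-∪ : {P Q : Pred (Fin m) 0ℓ} (P? : Decidable P) (Q? : Decidable Q) → P ⊥ Q →
               Balanced γ P? → Balanced γ Q? → Balanced γ (P? ∪? Q?)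
  Balanced-∪ {P} {Q} P? Q? P⊥Q balancedP balancedQ col = begin
    m * count ((P? ∪? Q?) ∩? colour? col)
      ≡⟨ cong (m *_) (count-cong ((P? ∪? Q?) ∩? colour? col) (Pcol? ∪? Qcol?) (distrib , undistrib)) ⟩
    m * count (Pcol? ∪? Qcol?)
      ≡⟨ cong (m *_) (count-∪ Pcol? Qcol? λ ((p , _) , (q , _)) → P⊥Q (p , q)) ⟩
    m * (count Pcol? + count Qcol?)
      ≡⟨ *-distribˡ-+ m _ _ ⟩
    m * count Pcol? + m * count Qcol?
      ≡⟨ cong₂ _+_ (balancedP col) (balancedQ col) ⟩
    count (colour? col) * count P? + count (colour? col) * count Q?
      ≡⟨ *-distribˡ-+ (count (colour? col)) _ _ ⟨
    count (colour? col) * (count P? + count Q?)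
      ≡⟨ cong (count (colour? col) *_) (count-∪ P? Q? P⊥Q) ⟨
    count (colour? col) * count (P? ∪? Q?)
      ∎
    where
    open ≡-Reasoning
    Pcol? : Decidable (P ∩ Colour col)
    Pcol? = P? ∩? colour? col
    Qcol? : Decidable (Q ∩ Colour col)
    Qcol? = Q? ∩? colour? col
    distrib : ∀ {i} → ((P ∪ Q) ∩ Colour col) i → ((P ∩ Colour col) ∪ (Q ∩ Colour col)) i
    distrib (inj₁ p , γi≡col) = inj₁ (p , γi≡col)
    distrib (inj₂ q , γi≡col) = inj₂ (q , γi≡col)
    undistrib : ∀ {i} → ((P ∩ Colour col) ∪ (Q ∩ Colour col)) i → ((P ∪ Q) ∩ Colour col) i
    undistrib (inj₁ (p , γi≡col)) = inj₁ p , γi≡col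
    undistrib (inj₂ (q , γi≡col)) = inj₂ q , γi≡col

descent : {X : Set} {P Q : X → Set} (μ : X → ℕ) →
          (∀ {x} → P x → Q x ⊎ ∃ λ y → P y × μ y < μ x) →
          ∀ {x} → P x → ∃ λ y → P y × Q y
descent {P = P} {Q} μ step {x} = go (On.wellFounded μ <-wellFounded x)
  where
  go : ∀ {x} → Acc (_<_ on μ) x → P x → ∃ λ y → P y × Q y
  go {x} (acc rs) px with step px
  ... | inj₁ qx = x , px , qx
  ... | inj₂ (y , py , μy<μx) = go (rs μy<μx) py

module _ {A : Set} (_≟_ : DecidableEquality A) where

  cluster? : ∀ {m n} (M : Matrix A m n) (s : Fin m) → Decidable (λ i → SameRow _≟_ M i s)
  cluster? M s i = sameRow? _≟_ M i s

  rowEq? : ∀ {n} (x y : Fin n → A) → Dec (x ≗ y)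
  rowEq? x y = all? λ j → x j ≟ y j

  replaceRow : ∀ {n} (b N x : Fin n → A) → Fin n → A
  replaceRow b N x with rowEq? x b
  ... | yes _ = N
  ... | no  _ = x

  replaceRow-hit : ∀ {n} {b N x : Fin n → A} → x ≗ b → replaceRow b N x ≡ N
  replaceRow-hit {b = b} {x = x} x≗b with rowEq? x b
  ... | yes _   = refl
  ... | no  x≉b = ⊥-elim (x≉b x≗b)

  replaceRow-miss : ∀ {n} {b N x : Fin n → A} → ¬ x ≗ b → replaceRow b N x ≡ x
  replaceRow-miss {b = b} {x = x} x≉b with rowEq? x b
  ... | yes x≗b = ⊥-elim (x≉b x≗b)
  ... | no  _   = refl

  replaceRow-cong : ∀ {n} {b N x y : Fin n → A} → x ≗ y → replaceRow b N x ≗ replaceRow b N y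
  replaceRow-cong {b = b} {N} {x} {y} x≗y with rowEq? x b
  ... | yes x≗b rewrite replaceRow-hit {N = N} (λ j → trans (sym (x≗y j)) (x≗b j)) = λ _ → refl
  ... | no  x≉b rewrite replaceRow-miss {N = N} (λ y≗b → x≉b λ j → trans (x≗y j) (y≗b j)) = x≗y

  AtMostDistinctRows-map : ∀ {m n r} {M : Matrix A m n} (F : (Fin n → A) → Fin n → A) →
                           (∀ {x y} → x ≗ y → F x ≗ F y) →
                           AtMostDistinctRows _≟_ M r → AtMostDistinctRows _≟_ (F ∘ M) r
  AtMostDistinctRows-map F F-cong (R , M≈R) = F ∘ R , λ i → proj₁ (M≈R i) , F-cong (proj₂ (M≈R i))

  overwriteCluster : ∀ {m n} → Matrix A m n → Fin m → (Fin n → A) → Matrix A m n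
  overwriteCluster M s₀ N i = replaceRow (M s₀) N (M i)

  -- The new cluster of s is Inside ∪ Outside: the old cluster of s₀ if N is the
  -- new row of s, and the rows outside it already equal to that row, which are
  -- either an old cluster or none.
  Fair-overwriteCluster : ∀ {m n c} {γ : Fin m → Fin c} (M : Matrix A m n) (s₀ : Fin m) (N : Fin n → A) →
                          Fair _≟_ M γ → Fair _≟_ (overwriteCluster M s₀ N) γ
  Fair-overwriteCluster {m} {γ = γ} M s₀ N fair s =
    Balanced-cong (Inside? ∪? Outside?) (cluster? M′ s) (merged⊆cluster , cluster⊆merged)
      (Balanced-∪ Inside? Outside? (λ ((c , _) , (¬c , _)) → ¬c c)
        (Inside-balanced (rowEq? N T)) (Outside-balanced (any? Outside?)))
    where
    M′ = overwriteCluster M s₀ N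
    T = M′ s
    C = λ i → SameRow _≟_ M i s₀
    Inside Outside : Pred (Fin m) 0ℓ
    Inside  i = C i × N ≗ T
    Outside i = ¬ C i × M i ≗ T
    Inside? : Decidable Inside
    Inside? i = cluster? M s₀ i ×-dec rowEq? N T
    Outside? : Decidable Outside
    Outside? i = ¬? (cluster? M s₀ i) ×-dec rowEq? (M i) T

    Inside-balanced : Dec (N ≗ T) → Balanced γ Inside?
    Inside-balanced (yes N≗T) = Balanced-cong (cluster? M s₀) Inside? ((_, N≗T) , proj₁) (fair s₀)
    Inside-balanced (no  N≉T) = Balanced-empty Inside? λ _ → N≉T ∘ proj₂

    Outside-balanced : Dec (Satisfiable Outside) → Balanced γ Outside?
    Outside-balanced (yes (i₁ , ¬c₁ , Mi₁≗T)) =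
      Balanced-cong (cluster? M i₁) Outside? (toOutside , fromOutside) (fair i₁)
      where
      toOutside : ∀ {i} → M i ≗ M i₁ → Outside i
      toOutside Mi≗Mi₁ = (λ c → ¬c₁ λ j → trans (sym (Mi≗Mi₁ j)) (c j)) ,
                         (λ j → trans (Mi≗Mi₁ j) (Mi₁≗T j))
      fromOutside : ∀ {i} → Outside i → M i ≗ M i₁
      fromOutside (_ , Mi≗T) j = trans (Mi≗T j) (sym (Mi₁≗T j))
    Outside-balanced (no ∄) = Balanced-empty Outside? λ i o → ∄ (i , o)

    merged⊆cluster : ∀ {i} → (Inside ∪ Outside) i → M′ i ≗ T
    merged⊆cluster (inj₁ (c , N≗T)) rewrite replaceRow-hit {N = N} c = N≗T
    merged⊆cluster (inj₂ (¬c , Mi≗T)) rewrite replaceRow-miss {N = N} ¬c = Mi≗T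

    cluster⊆merged : ∀ {i} → M′ i ≗ T → (Inside ∪ Outside) i
    cluster⊆merged {i} M′i≗T with cluster? M s₀ i
    ... | yes c rewrite replaceRow-hit {N = N} c = inj₁ (c , M′i≗T)
    ... | no ¬c rewrite replaceRow-miss {N = N} ¬c = inj₂ (¬c , M′i≗T)

  mismatches : ∀ {n} → (Fin n → A) → (Fin n → A) → ℕ
  mismatches x y = count λ j → ¬? (x j ≟ y j)

  mismatches-changeAt : ∀ {n} (x y y′ : Fin n → A) (j₀ : Fin n) {v w : A} →
                        (∀ j → j ≢ j₀ → y′ j ≡ y j) → y′ j₀ ≡ v → y j₀ ≡ w →
                        mismatches x y′ + 𝟙 (x j₀ ≟ v) ≡ mismatches x y + 𝟙 (x j₀ ≟ w)
  mismatches-changeAt x y y′ j₀ {v} {w} agree refl refl = begin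
    mismatches x y′ + 𝟙 (x j₀ ≟ v)
      ≡⟨ cong (_+ 𝟙 (x j₀ ≟ v)) (count≡sumFin-𝟙 (λ j → ¬? (x j ≟ y′ j))) ⟩
    sumFin (λ j → 𝟙 (¬? (x j ≟ y′ j))) + 𝟙 (x j₀ ≟ v)
      ≡⟨ sumFin-+-agreeExcept j₀ (λ j j≢j₀ → cong (λ z → 𝟙 (¬? (x j ≟ z))) (agree j j≢j₀))
                               (trans (𝟙-¬?+𝟙 (x j₀ ≟ v)) (sym (𝟙-¬?+𝟙 (x j₀ ≟ w)))) ⟩
    sumFin (λ j → 𝟙 (¬? (x j ≟ y j))) + 𝟙 (x j₀ ≟ w)
      ≡⟨ cong (_+ 𝟙 (x j₀ ≟ w)) (count≡sumFin-𝟙 (λ j → ¬? (x j ≟ y j))) ⟨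
    mismatches x y + 𝟙 (x j₀ ≟ w)
      ∎
    where open ≡-Reasoning

  dist-overwriteClusterAt : ∀ {m n} (M M′ : Matrix A m n) (s₀ : Fin m) (j₀ : Fin n) (v : A) →
    let C? = cluster? M′ s₀ in
    dist _≟_ M (overwriteCluster M′ s₀ (updateAt (M′ s₀) j₀ (const v)))
      + count (λ i → C? i ×-dec (M i j₀ ≟ v))
      ≡ dist _≟_ M M′ + count (λ i → C? i ×-dec (M i j₀ ≟ M′ s₀ j₀))
  dist-overwriteClusterAt M M′ s₀ j₀ v = begin
    dist _≟_ M M″ + count (agreesAt? v)
      ≡⟨ cong (dist _≟_ M M″ +_) (count≡sumFin-𝟙 (agreesAt? v)) ⟩
    dist _≟_ M M″ + sumFin (𝟙 ∘ agreesAt? v)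
      ≡⟨ sumFin-+-cong rowwise ⟩
    dist _≟_ M M′ + sumFin (𝟙 ∘ agreesAt? (M′ s₀ j₀))
      ≡⟨ cong (dist _≟_ M M′ +_) (count≡sumFin-𝟙 (agreesAt? (M′ s₀ j₀))) ⟨
    dist _≟_ M M′ + count (agreesAt? (M′ s₀ j₀))
      ∎
    where
    open ≡-Reasoning
    N = updateAt (M′ s₀) j₀ (const v)
    M″ = overwriteCluster M′ s₀ N
    agreesAt? : ∀ u i → Dec (SameRow _≟_ M′ i s₀ × M i j₀ ≡ u)
    agreesAt? u i = cluster? M′ s₀ i ×-dec (M i j₀ ≟ u)
    rowwise : ∀ i → mismatches (M i) (M″ i) + 𝟙 (agreesAt? v i)
                  ≡ mismatches (M i) (M′ i) + 𝟙 (agreesAt? (M′ s₀ j₀) i)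
    rowwise i with cluster? M′ s₀ i
    ... | yes c rewrite replaceRow-hit {N = N} c =
      mismatches-changeAt (M i) (M′ i) N j₀
        (λ j j≢j₀ → trans (updateAt-minimal j j₀ (M′ s₀) j≢j₀) (sym (c j)))
        (updateAt-updates j₀ (M′ s₀)) (c j₀)
    ... | no ¬c rewrite replaceRow-miss {N = N} ¬c = refl

  module _ {m n : ℕ} (M X : Matrix A m n) where

    votes : Fin m → Fin n → A → ℕ
    votes s j u = count λ i → cluster? X s i ×-dec (M i j ≟ u)

    -- Only values occurring in column j of M can outvote X[s,j], so ranging over
    -- rows i instead of values keeps violations decidable.
    MajorityViolation : Set
    MajorityViolation = ∃ λ s → ∃ λ j → ∃ λ i → votes s j (X s j) < votes s j (M i j)

    majorityConsistent⊎violation : MajorityConsistent _≟_ M X ⊎ MajorityViolation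
    majorityConsistent⊎violation with any? (λ s → any? λ j → any? λ i → votes s j (X s j) <? votes s j (M i j))
    ... | yes violation = inj₂ violation
    ... | no  ∄violation = inj₁ λ s j v → winner s j v (0 <? votes s j v)
      where
      winner : ∀ s j v → Dec (0 < votes s j v) → votes s j v ≤ votes s j (X s j)
      winner s j v (no  ¬0<votes) = ≤-trans (≮⇒≥ ¬0<votes) z≤n
      winner s j v (yes 0<votes) with 0<count⇒Satisfiable (λ i → cluster? X s i ×-dec (M i j ≟ v)) 0<votes
      ... | i , _ , Mij≡v rewrite sym Mij≡v = ≮⇒≥ λ beaten → ∄violation (s , j , i , beaten)

  Solution-improve : ∀ {m n c} {M X : Matrix A m n} {γ : Fin m → Fin c} {k r : ℕ} →
                     Solution _≟_ M γ k r X → MajorityViolation M X →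
                     ∃ λ X″ → Solution _≟_ M γ k r X″ × dist _≟_ M X″ < dist _≟_ M X
  Solution-improve {M = M} {X} (fair , dist≤k , distinct) (s , j , i , beaten) =
    X″ , (Fair-overwriteCluster X s N fair , ≤-trans (<⇒≤ closer) dist≤k ,
          AtMostDistinctRows-map (replaceRow (X s) N) replaceRow-cong distinct) ,
    closer
    where
    N = updateAt (X s) j (const (M i j))
    X″ = overwriteCluster X s N
    closer : dist _≟_ M X″ < dist _≟_ M X
    closer = +-cancelʳ-< (votes M X s j (M i j)) _ _
      (subst (_< dist _≟_ M X + votes M X s j (M i j)) (sym (dist-overwriteClusterAt M X s j (M i j)))
             (+-monoʳ-< (dist _≟_ M X) beaten))

  Solution-majorityConsistent⊎improvable :
    ∀ {m n c} {M X : Matrix A m n} {γ : Fin m → Fin c} {k r : ℕ} → Solution _≟_ M γ k r X →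
    MajorityConsistent _≟_ M X ⊎ ∃ λ X″ → Solution _≟_ M γ k r X″ × dist _≟_ M X″ < dist _≟_ M X
  Solution-majorityConsistent⊎improvable {M = M} {X} solution =
    map₂ (Solution-improve solution) (majorityConsistent⊎violation M X)

lemma8 : {A : Set} (_≟_ : DecidableEquality A) {m n c : ℕ}
         (M : Matrix A m n) (γ : Fin m → Fin c) (k r : ℕ) →
         1 ≤ k → 1 ≤ r →
         YesInstance _≟_ M γ k r →
         Σ (Matrix A m n) λ M* →
           Solution _≟_ M γ k r M* × MajorityConsistent _≟_ M M*
lemma8 _≟_ M γ k r _ _ (X , solution) =
  descent (dist _≟_ M) (Solution-majorityConsistent⊎improvable _≟_) solution
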